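{- Let $D\in\mathbb{N}$ and let $R,U$ be fixed resultant-string and transition functions on $\mathcal{M}_D$ as described in the context. Then there are only finitely many pairs $([j],M)$ with $j\in\mathbb{N}$, $M\in\mathcal{M}_D$ whose resultant string $R([j],M)$ is $[-1;1]$. Moreover, there is a constant $K_D$ depending only on $D$ such that if $c_1,\dots,c_k\in\mathbb{N}$ and $M\in\mathcal{M}_D$ satisfy $R([c_i],U([c_1,\dots,c_{i-1}],M))=[-1;1]$ for all $1\le i\le k$, then $k\le K_D$.
   Context: For $i\in\mathbb{Z}$ let $A_i=\begin{pmatrix}1&i\\0&1\end{pmatrix}$, $J=\begin{pmatrix}0&1\\1&0\end{pmatrix}$. For $D\in\mathbb{N}$, $\mathcal{M}_D$ is the set of integer $2\times2$ matrices $\begin{pmatrix}\alpha&\beta\\ \gamma&\delta\end{pmatrix}$ of determinant $\pm D$ satisfying one of: (I) $\gamma=0$, $\beta\ge0$, $\alpha,\delta>0$, $\beta<\delta$; (II) $\delta=0$, $\alpha\ge0$, $\beta,\gamma>0$, $\alpha<\gamma$; (III) $\alpha=0$, $\delta\ge0$, $\beta,\gamma>0$, $\delta<\beta$; (IV) $\beta=0$, $\gamma\ge0$, $\alpha,\delta>0$, $\gamma<\alpha$; (V) $\alpha<0$, $\beta,\gamma,\delta>0$, $|\alpha|<\gamma$; (VI) $\beta<0$, $\alpha,\gamma,\delta>0$, $|\beta|<\delta$. A string is $[c_0;c_1,\dots,c_n]$ with $c_0\ge-1$ an integer and $c_i\in\mathbb{N}$ for $i\ge1$; it is proper if $c_0=0$,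 written $[c_1,\dots,c_n]$; $[c]$ means $[0;c]$. Its associated matrix is $A_{c_0}JA_{c_1}\cdots JA_{c_n}$. The concatenation $s.s'$ of $s=[c_0;\dots,c_n]$ and $s'=[c_0';\dots,c'_{n'}]$ is the string associated to the product of their matrices, reduced by: if $c_n+c_0'>0$ then $A_{c_n}A_{c_0'}=A_{c_n+c_0'}$; if $c_n+c_0'=0$ then $A_{c_{n-1}}JA_{c_n}A_{c_0'}JA_{c_1'}=A_{c_{n-1}+c_1'}$ (so $[-1;1].[-1;1]$ is the empty string). For every $M\in\mathcal{M}_D$ and $j\in\mathbb{N}$ there exist $M'\in\mathcal{M}_D$, $m\ge0$, $d_0\ge-1$, $d_1,\dots,d_m\in\mathbb{N}$ (with $m\ge1$ if $d_0=-1$) such that $MJA_j=A_{d_0}JA_{d_1}\cdots JA_{d_m}M'$. Fix once and for all functions with $R([j],M)=[d_0;d_1,\dots,d_m]$ and $U([j],M)=M'$ satisfying this identity. Extend to proper strings by $U(\emptyset,M)=M$, $U([c_1,\dots,c_n],M)=U([c_2,\dots,c_n],U([c_1],M))$ and $R([c_1,\dots,c_n],M)=R([c_1],M).R([c_2,\dots,c_n],U([c_1],M))$. -}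

module Defs where

open import Data.Nat using (ℕ) renaming (_≤_ to _≤ℕ_)
open import Data.Integer using (ℤ; +_; -_; _+_; _-_; _*_; _<_; _≤_; 0ℤ; 1ℤ; -1ℤ)
open import Data.List using (List; []; _∷_; length; take)
open import Data.List.Relation.Unary.All using (All)
open import Data.Product using (_×_; _,_; proj₁; proj₂)
open import Data.Sum using (_⊎_)
open import Data.Fin using (Fin; toℕ)
open import Relation.Binary.PropositionalEquality using (_≡_)

record Mat : Set where
  constructor mat
  field
    α β γ δ : ℤ
open Mat public

_⊗_ : Mat → Mat → Mat
mat a b c d ⊗ mat a' b' c' d' =
  mat (a * a' + b * c') (a * b' + b * d') (c * a' + d * c') (c * b' + d * d')
infixl 7 _⊗_

I₂ : Mat
I₂ = mat 1ℤ 0ℤ 0ℤ 1ℤ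

A : ℤ → Mat
A i = mat 1ℤ i 0ℤ 1ℤ

J : Mat
J = mat 0ℤ 1ℤ 1ℤ 0ℤ

det : Mat → ℤ
det (mat a b c d) = a * d - b * c

data Shape : Mat → Set where
  typeI   : ∀ {a b d} → 0ℤ ≤ b → 0ℤ < a → 0ℤ < d → b < d → Shape (mat a b 0ℤ d)
  typeII  : ∀ {a b c} → 0ℤ ≤ a → 0ℤ < b → 0ℤ < c → a < c → Shape (mat a b c 0ℤ)
  typeIII : ∀ {b c d} → 0ℤ ≤ d → 0ℤ < b → 0ℤ < c → d < b → Shape (mat 0ℤ b c d)
  typeIV  : ∀ {a c d} → 0ℤ ≤ c → 0ℤ < a → 0ℤ < d → c < a → Shape (mat a 0ℤ c d)
  typeV   : ∀ {a b c d} → a < 0ℤ → 0ℤ < b → 0ℤ < c → 0ℤ < d → - a < c → Shape (mat a b c d)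
  typeVI  : ∀ {a b c d} → b < 0ℤ → 0ℤ < a → 0ℤ < c → 0ℤ < d → - b < d → Shape (mat a b c d)

InM : ℕ → Mat → Set
InM D M = (det M ≡ + D ⊎ det M ≡ - (+ D)) × Shape M

-- strings [c₀; c₁,…,cₙ]  as  (c₀ , c₁ ∷ … ∷ cₙ ∷ [])
Str : Set
Str = ℤ × List ℕ

ValidStr : Str → Set
ValidStr (c₀ , cs) = (-1ℤ ≤ c₀) × All (1 ≤ℕ_) cs × (c₀ ≡ -1ℤ → 1 ≤ℕ length cs)

tailMat : List ℕ → Mat
tailMat []       = I₂
tailMat (c ∷ cs) = J ⊗ A (+ c) ⊗ tailMat cs

strMat : Str → Mat
strMat (c₀ , cs) = A c₀ ⊗ tailMat cs

minusOneOne : Str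
minusOneOne = (-1ℤ , 1 ∷ [])

-- R, U are a valid choice of resultant-string / transition functions on 𝓜_D:
-- for M ∈ 𝓜_D, j ∈ ℕ (j ≥ 1): U j M ∈ 𝓜_D, R j M is a string as in the context,
-- and M J A_j = (matrix of R j M) · U j M.
IsRU : ℕ → (ℕ → Mat → Str) → (ℕ → Mat → Mat) → Set
IsRU D R U = ∀ j M → 1 ≤ℕ j → InM D M →
  InM D (U j M) × ValidStr (R j M) × (M ⊗ J ⊗ A (+ j) ≡ strMat (R j M) ⊗ U j M)

Uext : (ℕ → Mat → Mat) → List ℕ → Mat → Mat
Uext U []       M = M
Uext U (c ∷ cs) M = Uext U cs (U c M)

-- If M J A_j = N M' with N the matrix of [-1;1], then M' = N M J A_j since N² = I, so
-- α' = -β and β' = -(α + β j).  Comparing the shapes of M and M' according to the sign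
-- of β shows β ≠ 0 and that α + β j and β j have opposite signs, whence
-- |α| = |β'| + |β| j.  Thus j ≤ |α|, and along a chain of [-1;1]-steps |α| strictly
-- decreases, because |α'| = |β| ≤ |β| j < |α| as soon as M' admits another such step
-- (which forces β' ≠ 0).  Finally every entry of a matrix in 𝓜_D is at most |det| = D.

module Submission where

open import Defs
open import Data.Nat as ℕ using (ℕ; suc; z≤n; s≤s; z<s; _≤_; _<_)
open import Data.Nat.Properties as ℕ using (m≤m*n; m≤n*m; m≤n+m; m<n+m; m≤m+n; n≢0⇒n>0; +-suc)
open import Data.Integer as ℤ using (ℤ; +_; -[1+_]; -_; _+_; _-_; _*_; ∣_∣; 0ℤ; 1ℤ)
open import Data.Integer.Properties as ℤ
  using (<-cmp; <⇒≤; <⇒≢; ≰⇒>; <⇒≱; <-asym; neg-mono-<; neg-mono-≤; neg-cancel-<; neg-cancel-≤;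
         neg-distrib-+; ∣-i∣≡∣i∣; ∣i∣≡0⇒i≡0; abs-*; 0≤i⇒+∣i∣≡i; +-identityʳ; +-identityˡ; +-mono-<; +-mono-<-≤; *-monoʳ-≤-nonNeg)
open import Data.Integer.Tactic.RingSolver using (solve-∀)
open import Data.List using (List; []; _∷_; _++_; length; lookup; take; applyUpTo; upTo; cartesianProduct; cartesianProductWith)
open import Data.List.Relation.Unary.All using (All; _∷_)
open import Data.List.Membership.Propositional using (_∈_)
open import Data.List.Membership.Propositional.Properties
  using (∈-++⁺ˡ; ∈-++⁺ʳ; ∈-applyUpTo⁺; ∈-cartesianProduct⁺; ∈-cartesianProductWith⁺)
open import Data.Fin as Fin using (Fin; toℕ)
open import Data.Product using (Σ; _×_; _,_; proj₁; proj₂)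
open import Data.Sum using (inj₁; inj₂)
open import Function using (_∘_; _$_; id)
open import Relation.Binary.Definitions using (tri<; tri≈; tri>)
open import Relation.Binary.PropositionalEquality using (_≡_; _≢_; refl; sym; trans; cong; cong₂; subst; module ≡-Reasoning)
open import Relation.Nullary using (contradiction)

∣i∣≡∣i+k∣+∣k∣ : ∀ {i k} → k ℤ.≤ 0ℤ → 0ℤ ℤ.≤ i + k → ∣ i ∣ ≡ ∣ i + k ∣ ℕ.+ ∣ k ∣
∣i∣≡∣i+k∣+∣k∣ {i} {k} k≤0 0≤i+k = begin
  ∣ i ∣                        ≡⟨ cong ∣_∣ (i≡[i+k]-k i k) ⟩
  ∣ i + k + - k ∣              ≡⟨ cong ∣_∣ (cong₂ _+_ (0≤i⇒+∣i∣≡i 0≤i+k) (0≤i⇒+∣i∣≡i (neg-mono-≤ k≤0))) ⟨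
  ∣ + ∣ i + k ∣ + + ∣ - k ∣ ∣  ≡⟨ cong (∣ i + k ∣ ℕ.+_) (∣-i∣≡∣i∣ k) ⟩
  ∣ i + k ∣ ℕ.+ ∣ k ∣          ∎
  where
  i≡[i+k]-k : ∀ i k → i ≡ i + k + - k
  i≡[i+k]-k = solve-∀
  open ≡-Reasoning

∣i∣≡∣i+k∣+∣k∣′ : ∀ {i k} → 0ℤ ℤ.≤ k → i + k ℤ.≤ 0ℤ → ∣ i ∣ ≡ ∣ i + k ∣ ℕ.+ ∣ k ∣
∣i∣≡∣i+k∣+∣k∣′ {i} {k} 0≤k i+k≤0 = begin
  ∣ i ∣                          ≡⟨ ∣-i∣≡∣i∣ i ⟨
  ∣ - i ∣                        ≡⟨ ∣i∣≡∣i+k∣+∣k∣ { - i} (neg-mono-≤ 0≤k) (subst (0ℤ ℤ.≤_) (neg-distrib-+ i k) (neg-mono-≤ i+k≤0)) ⟩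
  ∣ - i + - k ∣ ℕ.+ ∣ - k ∣      ≡⟨ cong₂ ℕ._+_ (trans (cong ∣_∣ (sym (neg-distrib-+ i k))) (∣-i∣≡∣i∣ (i + k))) (∣-i∣≡∣i∣ k) ⟩
  ∣ i + k ∣ ℕ.+ ∣ k ∣            ∎
  where open ≡-Reasoning

mat-cong : ∀ {a b c d a' b' c' d'} → a ≡ a' → b ≡ b' → c ≡ c' → d ≡ d' → mat a b c d ≡ mat a' b' c' d'
mat-cong refl refl refl refl = refl

N : Mat
N = strMat minusOneOne

N-involutive : ∀ M → N ⊗ (N ⊗ M) ≡ M
N-involutive (mat a b c d) = mat-cong (top a c) (top b d) (bottom a c) (bottom b d)
  where
  top : ∀ x z → - 1ℤ * (- 1ℤ * x + 0ℤ * z) + 0ℤ * (1ℤ * x + 1ℤ * z) ≡ x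
  top = solve-∀
  bottom : ∀ x z → 1ℤ * (- 1ℤ * x + 0ℤ * z) + 1ℤ * (1ℤ * x + 1ℤ * z) ≡ z
  bottom = solve-∀

⊗J⊗A : ∀ a b c d j → mat a b c d ⊗ J ⊗ A j ≡ mat b (a + b * j) d (c + d * j)
⊗J⊗A a b c d j = mat-cong (left a b) (right a b j) (left c d) (right c d j)
  where
  left : ∀ x y → (x * 0ℤ + y * 1ℤ) * 1ℤ + (x * 1ℤ + y * 0ℤ) * 0ℤ ≡ y
  left = solve-∀
  right : ∀ x y t → (x * 0ℤ + y * 1ℤ) * t + (x * 1ℤ + y * 0ℤ) * 1ℤ ≡ x + y * t
  right = solve-∀

N⊗ : ∀ a b c d → N ⊗ mat a b c d ≡ mat (- a) (- b) (a + c) (b + d)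
N⊗ a b c d = mat-cong (top a c) (top b d) (bottom a c) (bottom b d)
  where
  top : ∀ x z → - 1ℤ * x + 0ℤ * z ≡ - x
  top = solve-∀
  bottom : ∀ x z → 1ℤ * x + 1ℤ * z ≡ x + z
  bottom = solve-∀

successor : Mat → ℕ → Mat
successor (mat a b c d) j = mat (- b) (- (a + b * + j)) (b + d) (a + c + (b + d) * + j)

N⊗M⊗J⊗A≡successor : ∀ M j → N ⊗ (M ⊗ J ⊗ A (+ j)) ≡ successor M j
N⊗M⊗J⊗A≡successor (mat a b c d) j = begin
  N ⊗ (mat a b c d ⊗ J ⊗ A (+ j))                                   ≡⟨ cong (N ⊗_) (⊗J⊗A a b c d (+ j)) ⟩
  N ⊗ mat b (a + b * + j) d (c + d * + j)                           ≡⟨ N⊗ b (a + b * + j) d (c + d * + j) ⟩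
  mat (- b) (- (a + b * + j)) (b + d) (a + b * + j + (c + d * + j)) ≡⟨ cong (mat (- b) (- (a + b * + j)) (b + d)) (regroup a b c d (+ j)) ⟩
  successor (mat a b c d) j                                         ∎
  where
  regroup : ∀ a b c d t → a + b * t + (c + d * t) ≡ a + c + (b + d) * t
  regroup = solve-∀
  open ≡-Reasoning

successor-unique : ∀ {M M' j} → M ⊗ J ⊗ A (+ j) ≡ N ⊗ M' → M' ≡ successor M j
successor-unique {M} {M'} {j} e = begin
  M'                    ≡⟨ N-involutive M' ⟨
  N ⊗ (N ⊗ M')          ≡⟨ cong (N ⊗_) e ⟨
  N ⊗ (M ⊗ J ⊗ A (+ j)) ≡⟨ N⊗M⊗J⊗A≡successor M j ⟩
  successor M j         ∎
  where open ≡-Reasoning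

α≤0⇒0<β : ∀ {M} → Shape M → α M ℤ.≤ 0ℤ → 0ℤ ℤ.< β M
α≤0⇒0<β (typeI _ 0<a _ _)     a≤0 = contradiction a≤0 (<⇒≱ 0<a)
α≤0⇒0<β (typeII _ 0<b _ _)    _   = 0<b
α≤0⇒0<β (typeIII _ 0<b _ _)   _   = 0<b
α≤0⇒0<β (typeIV _ 0<a _ _)    a≤0 = contradiction a≤0 (<⇒≱ 0<a)
α≤0⇒0<β (typeV _ 0<b _ _ _)   _   = 0<b
α≤0⇒0<β (typeVI _ 0<a _ _ _)  a≤0 = contradiction a≤0 (<⇒≱ 0<a)

β≤0⇒0<α : ∀ {M} → Shape M → β M ℤ.≤ 0ℤ → 0ℤ ℤ.< α M
β≤0⇒0<α s b≤0 = ≰⇒> λ a≤0 → <⇒≱ (α≤0⇒0<β s a≤0) b≤0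

β<0⇒0<γ∧0<β+δ : ∀ {M} → Shape M → β M ℤ.< 0ℤ → 0ℤ ℤ.< γ M × 0ℤ ℤ.< β M + δ M
β<0⇒0<γ∧0<β+δ (typeI 0≤b _ _ _)         b<0 = contradiction 0≤b (<⇒≱ b<0)
β<0⇒0<γ∧0<β+δ (typeII _ 0<b _ _)        b<0 = contradiction b<0 (<-asym 0<b)
β<0⇒0<γ∧0<β+δ (typeIII _ 0<b _ _)       b<0 = contradiction b<0 (<-asym 0<b)
β<0⇒0<γ∧0<β+δ (typeIV _ _ _ _)          (ℤ.+<+ ())
β<0⇒0<γ∧0<β+δ (typeV _ 0<b _ _ _)       b<0 = contradiction b<0 (<-asym 0<b)
β<0⇒0<γ∧0<β+δ (typeVI {b = b} {d = d} _ _ 0<c _ -b<d) _ =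
  0<c , subst (ℤ._< b + d) (ℤ.+-inverseʳ b) (ℤ.+-monoʳ-< b -b<d)

0<α∧0<γ∧0<δ⇒β≤0 : ∀ {M} → Shape M → 0ℤ ℤ.< α M → 0ℤ ℤ.< γ M → 0ℤ ℤ.< δ M → β M ℤ.≤ 0ℤ
0<α∧0<γ∧0<δ⇒β≤0 (typeI _ _ _ _)        _   (ℤ.+<+ ()) _
0<α∧0<γ∧0<δ⇒β≤0 (typeII _ _ _ _)       _   _          (ℤ.+<+ ())
0<α∧0<γ∧0<δ⇒β≤0 (typeIII _ _ _ _)      (ℤ.+<+ ()) _   _
0<α∧0<γ∧0<δ⇒β≤0 (typeIV _ _ _ _)       _   _   _ = ℤ.≤-refl
0<α∧0<γ∧0<δ⇒β≤0 (typeV a<0 _ _ _ _)    0<a _   _ = contradiction a<0 (<-asym 0<a)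
0<α∧0<γ∧0<δ⇒β≤0 (typeVI b<0 _ _ _ _)   _   _   _ = <⇒≤ b<0

-- β < 0 leaves M' only the types IV and VI (so β' ≤ 0), β > 0 only type V (so β' > 0),
-- and β = 0 no type at all.
successor-shape⇒β≢0∧∣α∣-split : ∀ {a b c d j} → Shape (mat a b c d) → Shape (successor (mat a b c d) j) →
                           b ≢ 0ℤ × ∣ a ∣ ≡ ∣ a + b * + j ∣ ℕ.+ ∣ b * + j ∣
successor-shape⇒β≢0∧∣α∣-split {a} {b} {c} {d} {j} s s' with <-cmp b 0ℤ
... | tri< b<0 _ _ = <⇒≢ b<0 , ∣i∣≡∣i+k∣+∣k∣ {a} (*-monoʳ-≤-nonNeg (+ j) (<⇒≤ b<0)) (neg-cancel-≤ {j = 0ℤ} β'≤0)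
  where
  0<a : 0ℤ ℤ.< a
  0<a = β≤0⇒0<α s (<⇒≤ b<0)
  0<δ' : 0ℤ ℤ.< a + c + (b + d) * + j
  0<δ' with 0<c , 0<b+d ← β<0⇒0<γ∧0<β+δ s b<0 =
    +-mono-<-≤ (+-mono-< 0<a 0<c) (*-monoʳ-≤-nonNeg (+ j) (<⇒≤ 0<b+d))
  β'≤0 : - (a + b * + j) ℤ.≤ 0ℤ
  β'≤0 = 0<α∧0<γ∧0<δ⇒β≤0 s' (neg-mono-< b<0) (proj₂ (β<0⇒0<γ∧0<β+δ s b<0)) 0<δ'
... | tri≈ _ refl _ =
  contradiction (neg-cancel-< {0ℤ} (subst (λ x → 0ℤ ℤ.< - x) (+-identityʳ a) (α≤0⇒0<β s' ℤ.≤-refl)))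
                (<-asym (β≤0⇒0<α s ℤ.≤-refl))
... | tri> _ _ 0<b = (λ b≡0 → <⇒≢ 0<b (sym b≡0)) , ∣i∣≡∣i+k∣+∣k∣′ {a} (*-monoʳ-≤-nonNeg (+ j) (<⇒≤ 0<b)) (<⇒≤ a+bj<0)
  where
  a+bj<0 : a + b * + j ℤ.< 0ℤ
  a+bj<0 = neg-cancel-< {0ℤ} (α≤0⇒0<β s' (<⇒≤ (neg-mono-< 0<b)))

successor-invariant : ∀ {M j} → Shape M → Shape (successor M j) →
                      β M ≢ 0ℤ × ∣ α M ∣ ≡ ∣ β (successor M j) ∣ ℕ.+ ∣ β M ∣ ℕ.* j
successor-invariant {mat a b c d} {j} s s' with b≢0 , split ← successor-shape⇒β≢0∧∣α∣-split s s' =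
  b≢0 , trans split (cong₂ ℕ._+_ (sym (∣-i∣≡∣i∣ (a + b * + j))) (abs-* b (+ j)))

successor-shape⇒j≤∣α∣ : ∀ {M j} → Shape M → Shape (successor M j) → j ≤ ∣ α M ∣
successor-shape⇒j≤∣α∣ {M} {j} s s' with β≢0 , invariant ← successor-invariant s s' = begin
  j                                          ≤⟨ m≤n*m j ∣ β M ∣ {{ℕ.≢-nonZero (β≢0 ∘ ∣i∣≡0⇒i≡0)}} ⟩
  ∣ β M ∣ ℕ.* j                              ≤⟨ m≤n+m _ _ ⟩
  ∣ β (successor M j) ∣ ℕ.+ ∣ β M ∣ ℕ.* j    ≡⟨ invariant ⟨
  ∣ α M ∣                                    ∎
  where open ℕ.≤-Reasoning

successor-shape⇒∣α∣-descent : ∀ {M j} → 1 ≤ j → Shape M → Shape (successor M j) → β (successor M j) ≢ 0ℤ →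
                              ∣ α (successor M j) ∣ < ∣ α M ∣
successor-shape⇒∣α∣-descent {mat a b c d} {j} 1≤j s s' β'≢0 with _ , invariant ← successor-invariant s s' = begin-strict
  ∣ - b ∣                                           ≡⟨ ∣-i∣≡∣i∣ b ⟩
  ∣ b ∣                                             ≤⟨ m≤m*n ∣ b ∣ j {{ℕ.>-nonZero 1≤j}} ⟩
  ∣ b ∣ ℕ.* j                                       <⟨ m<n+m _ (n≢0⇒n>0 (β'≢0 ∘ ∣i∣≡0⇒i≡0)) ⟩
  ∣ - (a + b * + j) ∣ ℕ.+ ∣ b ∣ ℕ.* j               ≡⟨ invariant ⟨
  ∣ a ∣                                             ∎
  where open ℕ.≤-Reasoning

EntriesBoundedBy : ℕ → Mat → Set
EntriesBoundedBy n M = ∣ α M ∣ ≤ n × ∣ β M ∣ ≤ n × ∣ γ M ∣ ≤ n × ∣ δ M ∣ ≤ n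

∣det∣≡∣αδ∣ : ∀ {M} → β M * γ M ≡ 0ℤ → ∣ det M ∣ ≡ ∣ α M * δ M ∣
∣det∣≡∣αδ∣ {mat a b c d} bc≡0 = cong ∣_∣ (begin
  a * d - b * c  ≡⟨ cong (λ x → a * d - x) bc≡0 ⟩
  a * d - 0ℤ     ≡⟨ +-identityʳ (a * d) ⟩
  a * d          ∎)
  where open ≡-Reasoning

∣det∣≡∣βγ∣ : ∀ {M} → α M * δ M ≡ 0ℤ → ∣ det M ∣ ≡ ∣ β M * γ M ∣
∣det∣≡∣βγ∣ {mat a b c d} ad≡0 = begin
  ∣ a * d - b * c ∣  ≡⟨ cong (λ x → ∣ x - b * c ∣) ad≡0 ⟩
  ∣ 0ℤ - b * c ∣     ≡⟨ cong ∣_∣ (+-identityˡ (- (b * c))) ⟩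
  ∣ - (b * c) ∣      ≡⟨ ∣-i∣≡∣i∣ (b * c) ⟩
  ∣ b * c ∣          ∎
  where open ≡-Reasoning

factors≤product : ∀ p q → suc p ≤ suc p ℕ.* suc q × suc q ≤ suc p ℕ.* suc q
factors≤product p q = m≤m*n (suc p) (suc q) , m≤n*m (suc q) (suc p)

factors≤sum-of-products : ∀ p q r s → let n = suc p ℕ.* suc s ℕ.+ suc q ℕ.* suc r in
                          suc p ≤ n × suc q ≤ n × suc r ≤ n × suc s ≤ n
factors≤sum-of-products p q r s =
  ℕ.≤-trans (m≤m*n (suc p) (suc s)) (m≤m+n _ _) , ℕ.≤-trans (m≤m*n (suc q) (suc r)) (m≤n+m _ (suc p ℕ.* suc s)) ,
  ℕ.≤-trans (m≤n*m (suc r) (suc q)) (m≤n+m _ (suc p ℕ.* suc s)) , ℕ.≤-trans (m≤n*m (suc s) (suc p)) (m≤m+n _ _)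

Shape⇒entries≤∣det∣ : ∀ {M} → Shape M → EntriesBoundedBy ∣ det M ∣ M
Shape⇒entries≤∣det∣ {M} (typeI {b = b} (ℤ.+≤+ z≤n) (ℤ.+<+ (z<s {p})) (ℤ.+<+ (z<s {r})) (ℤ.+<+ b<d))
  with p≤ , r≤ ← factors≤product p r =
  subst (λ n → EntriesBoundedBy n M) (sym (∣det∣≡∣αδ∣ {M} (ℤ.*-zeroʳ b))) (p≤ , ℕ.≤-trans (ℕ.<⇒≤ b<d) r≤ , z≤n , r≤)
Shape⇒entries≤∣det∣ {M} (typeII {a = a} (ℤ.+≤+ z≤n) (ℤ.+<+ (z<s {p})) (ℤ.+<+ (z<s {r})) (ℤ.+<+ a<c))
  with p≤ , r≤ ← factors≤product p r =
  subst (λ n → EntriesBoundedBy n M) (sym (∣det∣≡∣βγ∣ {M} (ℤ.*-zeroʳ a))) (ℕ.≤-trans (ℕ.<⇒≤ a<c) r≤ , p≤ , r≤ , z≤n)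
Shape⇒entries≤∣det∣ {M} (typeIII (ℤ.+≤+ z≤n) (ℤ.+<+ (z<s {p})) (ℤ.+<+ (z<s {r})) (ℤ.+<+ d<b))
  with p≤ , r≤ ← factors≤product p r =
  subst (λ n → EntriesBoundedBy n M) (sym (∣det∣≡∣βγ∣ {M} refl)) (z≤n , p≤ , r≤ , ℕ.≤-trans (ℕ.<⇒≤ d<b) p≤)
Shape⇒entries≤∣det∣ {M} (typeIV (ℤ.+≤+ z≤n) (ℤ.+<+ (z<s {p})) (ℤ.+<+ (z<s {r})) (ℤ.+<+ c<a))
  with p≤ , r≤ ← factors≤product p r =
  subst (λ n → EntriesBoundedBy n M) (sym (∣det∣≡∣αδ∣ {M} refl)) (p≤ , z≤n , ℕ.≤-trans (ℕ.<⇒≤ c<a) p≤ , r≤)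
Shape⇒entries≤∣det∣ {M} (typeV (ℤ.-<+ {p}) (ℤ.+<+ (z<s {q})) (ℤ.+<+ (z<s {r})) (ℤ.+<+ (z<s {s})) _) =
  subst (λ n → EntriesBoundedBy n M) (cong suc (+-suc _ _)) (factors≤sum-of-products p q r s)
Shape⇒entries≤∣det∣ {M} (typeVI (ℤ.-<+ {q}) (ℤ.+<+ (z<s {p})) (ℤ.+<+ (z<s {r})) (ℤ.+<+ (z<s {s})) _) =
  factors≤sum-of-products p q r s

InM⇒∣det∣≡D : ∀ {D M} → InM D M → ∣ det M ∣ ≡ D
InM⇒∣det∣≡D     (inj₁ det≡D  , _) = cong ∣_∣ det≡D
InM⇒∣det∣≡D {D} (inj₂ det≡-D , _) = trans (cong ∣_∣ det≡-D) (∣-i∣≡∣i∣ (+ D))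

InM⇒entries≤D : ∀ {D M} → InM D M → EntriesBoundedBy D M
InM⇒entries≤D {M = M} M∈ = subst (λ n → EntriesBoundedBy n M) (InM⇒∣det∣≡D M∈) (Shape⇒entries≤∣det∣ (proj₂ M∈))

ℤ-range : ℕ → List ℤ
ℤ-range n = applyUpTo +_ (suc n) ++ applyUpTo -[1+_] n

∈-ℤ-range : ∀ {n} x → ∣ x ∣ ≤ n → x ∈ ℤ-range n
∈-ℤ-range     (+ m)    m≤n = ∈-++⁺ˡ (∈-applyUpTo⁺ +_ (s≤s m≤n))
∈-ℤ-range {n} -[1+ m ] m<n = ∈-++⁺ʳ (applyUpTo +_ (suc n)) (∈-applyUpTo⁺ -[1+_] m<n)

matricesOver : List ℤ → List Mat
matricesOver zs = cartesianProductWith _$_ (cartesianProductWith _$_ (cartesianProductWith mat zs zs) zs) zs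

∈-matricesOver : ∀ {zs a b c d} → a ∈ zs → b ∈ zs → c ∈ zs → d ∈ zs → mat a b c d ∈ matricesOver zs
∈-matricesOver a∈ b∈ c∈ d∈ =
  ∈-cartesianProductWith⁺ _$_ (∈-cartesianProductWith⁺ _$_ (∈-cartesianProductWith⁺ mat a∈ b∈) c∈) d∈

candidates : ℕ → List (ℕ × Mat)
candidates D = cartesianProduct (upTo (suc D)) (matricesOver (ℤ-range D))

∈-candidates : ∀ {D j M} → j ≤ D → EntriesBoundedBy D M → (j , M) ∈ candidates D
∈-candidates {M = mat a b c d} j≤D (a≤ , b≤ , c≤ , d≤) =
  ∈-cartesianProduct⁺ (∈-applyUpTo⁺ id (s≤s j≤D))
    (∈-matricesOver (∈-ℤ-range a a≤) (∈-ℤ-range b b≤) (∈-ℤ-range c c≤) (∈-ℤ-range d d≤))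

module _ {D : ℕ} {R : ℕ → Mat → Str} {U : ℕ → Mat → Mat} (isRU : IsRU D R U) where

  U≡successor : ∀ {j M} → 1 ≤ j → InM D M → R j M ≡ minusOneOne → U j M ≡ successor M j
  U≡successor {j} {M} 1≤j M∈ R≡ =
    successor-unique {M} (subst (λ r → M ⊗ J ⊗ A (+ j) ≡ strMat r ⊗ U j M) R≡ (proj₂ (proj₂ (isRU j M 1≤j M∈))))

  U-InM : ∀ {j M} → 1 ≤ j → InM D M → InM D (U j M)
  U-InM {j} {M} 1≤j M∈ = proj₁ (isRU j M 1≤j M∈)

  successor-shape : ∀ {j M} → 1 ≤ j → InM D M → R j M ≡ minusOneOne → Shape (successor M j)
  successor-shape 1≤j M∈ R≡ = subst Shape (U≡successor 1≤j M∈ R≡) (proj₂ (U-InM 1≤j M∈))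

  R≡minusOneOne⇒j≤∣α∣ : ∀ {j M} → 1 ≤ j → InM D M → R j M ≡ minusOneOne → j ≤ ∣ α M ∣
  R≡minusOneOne⇒j≤∣α∣ 1≤j M∈ R≡ = successor-shape⇒j≤∣α∣ (proj₂ M∈) (successor-shape 1≤j M∈ R≡)

  R≡minusOneOne⇒β≢0 : ∀ {j M} → 1 ≤ j → InM D M → R j M ≡ minusOneOne → β M ≢ 0ℤ
  R≡minusOneOne⇒β≢0 1≤j M∈ R≡ = proj₁ (successor-invariant (proj₂ M∈) (successor-shape 1≤j M∈ R≡))

  R≡minusOneOne²⇒∣α∣-descent : ∀ {j j' M} → 1 ≤ j → InM D M → R j M ≡ minusOneOne →
                                1 ≤ j' → R j' (U j M) ≡ minusOneOne → ∣ α (U j M) ∣ < ∣ α M ∣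
  R≡minusOneOne²⇒∣α∣-descent {j} {j'} {M} 1≤j M∈ R≡ 1≤j' R'≡ =
    subst (λ M' → ∣ α M' ∣ < ∣ α M ∣) (sym U≡)
      (successor-shape⇒∣α∣-descent 1≤j (proj₂ M∈) (successor-shape 1≤j M∈ R≡)
        (subst (λ M' → β M' ≢ 0ℤ) U≡ (R≡minusOneOne⇒β≢0 1≤j' (U-InM 1≤j M∈) R'≡)))
    where
    U≡ : U j M ≡ successor M j
    U≡ = U≡successor 1≤j M∈ R≡

  chain-length≤1+∣α∣ : ∀ cs M → All (1 ≤_) cs → InM D M →
                       (∀ (i : Fin (length cs)) → R (lookup cs i) (Uext U (take (toℕ i) cs) M) ≡ minusOneOne) →
                       length cs ≤ suc ∣ α M ∣
  chain-length≤1+∣α∣ []            _ _                       _  _     = z≤n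
  chain-length≤1+∣α∣ (_ ∷ [])      _ _                       _  _     = s≤s z≤n
  chain-length≤1+∣α∣ (c ∷ c' ∷ cs) M (1≤c ∷ 1≤cs@(1≤c' ∷ _)) M∈ steps =
    s≤s (ℕ.≤-trans (chain-length≤1+∣α∣ (c' ∷ cs) (U c M) 1≤cs (U-InM 1≤c M∈) (steps ∘ Fin.suc))
                   (R≡minusOneOne²⇒∣α∣-descent 1≤c M∈ (steps Fin.zero) 1≤c' (steps (Fin.suc Fin.zero))))

lemma2p3 : (D : ℕ) → 1 ≤ D → (R : ℕ → Mat → Str) → (U : ℕ → Mat → Mat) → IsRU D R U →
    (Σ (List (ℕ × Mat)) λ L →
        ∀ j M → 1 ≤ j → InM D M → R j M ≡ minusOneOne → (j , M) ∈ L)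
    × (Σ ℕ λ K →
        ∀ (cs : List ℕ) M → All (1 ≤_) cs → InM D M →
          (∀ (i : Fin (length cs)) → R (lookup cs i) (Uext U (take (toℕ i) cs) M) ≡ minusOneOne) →
          length cs ≤ K)
lemma2p3 D _ R U isRU = (candidates D , pairs-bounded) , (suc D , chains-bounded)
  where
  pairs-bounded : ∀ j M → 1 ≤ j → InM D M → R j M ≡ minusOneOne → (j , M) ∈ candidates D
  pairs-bounded j M 1≤j M∈ R≡ =
    ∈-candidates (ℕ.≤-trans (R≡minusOneOne⇒j≤∣α∣ isRU 1≤j M∈ R≡) (proj₁ (InM⇒entries≤D M∈))) (InM⇒entries≤D M∈)
  chains-bounded : ∀ cs M → All (1 ≤_) cs → InM D M →
                   (∀ (i : Fin (length cs)) → R (lookup cs i) (Uext U (take (toℕ i) cs) M) ≡ minusOneOne) →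
                   length cs ≤ suc D
  chains-bounded cs M 1≤cs M∈ steps =
    ℕ.≤-trans (chain-length≤1+∣α∣ isRU cs M 1≤cs M∈ steps) (s≤s (proj₁ (InM⇒entries≤D M∈)))
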